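{- Let $w\in S_\infty$, $k\leq l$, and let $\eta=\eta_1+2\eta_2\in\tilde B_{k,l}(w)$, written as $\eta=\alpha+\beta$ with $\alpha\in A_l(w)$ and $\beta\in A_k(w)$. If $k<l$, then the following are equivalent: $\eta\notin B_{k,l}(w)$; $\beta\subseteq\alpha$; $k=|\eta_2|$. If $k=l$, then $\eta\notin B_{k,l}(w)$ holds exactly when either $k=|\eta_2|$ or $k=|\eta_2|+1$ (i.e. $k\leq|\eta_2|+1$), and in no other case.
   Context: For $w\in S_\infty$ and $m\geq1$, $w^m$ is the increasing ordering of $w(1),\dots,w(m)$; for strictly increasing sequences of equal length, $\alpha\leq\gamma$ means entrywise $\leq$. $A_m(w)$ is the set of strictly increasing sequences of $m$ positive integers that are $\leq w^m$; sequences are identified with finite sets. A multi-set with multiplicities at most 2 is written $\eta=\eta_1+2\eta_2$ ($\eta_1,\eta_2$ disjoint sets of elements of multiplicity 1, 2); for sets $\alpha,\beta$, $\alpha+\beta$ is their multi-set union. For $k\leq l$: $\tilde B_{k,l}(w)$ is the set of multi-sets $\alpha+\beta$ with $\alpha\in A_l(w)$, $\beta\in A_k(w)$; $B_{k,l}(w)$ is the set of multi-sets $\eta$ for which there are $\alpha,\tilde\alpha\in A_l(w)$ and $\beta,\tilde\beta\in A_k(w)$ with $\eta=\alpha+\beta=\tilde\alpha+\tilde\beta$ and $\alpha\neq\tilde\alpha$, $\alpha\neq\tilde\beta$, $\beta\neq\tilde\alpha$, $\beta\neq\tilde\beta$. -}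

module Defs where

open import Data.Nat using (ℕ; zero; suc; _+_; _≤_; _<_)
open import Data.Nat.Properties using (≤-decTotalOrder; _≟_)
open import Data.List using (List; []; _∷_; length; filter; map; upTo; _++_)
open import Data.List.Relation.Unary.All using (All)
open import Data.List.Relation.Unary.Linked using (Linked)
open import Data.List.Relation.Binary.Pointwise using (Pointwise)
open import Data.List.Sort.InsertionSort ≤-decTotalOrder using (sort)
open import Data.Product using (Σ; ∃; _×_; ∃-syntax)
open import Function.Definitions using (Injective; Surjective)
open import Relation.Binary.PropositionalEquality using (_≡_; _≢_)

-- We use functions ℕ → ℕ with w 0 ≡ 0, so that the
-- restriction to the positive integers {1,2,…} is the permutation itself.
record S∞ : Set where
  field
    fun    : ℕ → ℕ
    fix0   : fun 0 ≡ 0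
    inj    : Injective _≡_ _≡_ fun
    surj   : Surjective _≡_ _≡_ fun
    finite : ∃[ N ] (∀ i → N ≤ i → fun i ≡ i)
open S∞ public

wUpTo : S∞ → ℕ → List ℕ
wUpTo w m = sort (map (λ i → fun w (suc i)) (upTo m))

StrictlyIncreasing : List ℕ → Set
StrictlyIncreasing = Linked _<_

Positive : ℕ → Set
Positive x = 1 ≤ x

InA : S∞ → ℕ → List ℕ → Set
InA w m α =
  StrictlyIncreasing α × All Positive α × length α ≡ m × Pointwise _≤_ α (wUpTo w m)

count : ℕ → List ℕ → ℕ
count x α = length (filter (_≟ x) α)

Multiset : Set
Multiset = ℕ → ℕ

_⊕_ : List ℕ → List ℕ → Multiset
(α ⊕ β) x = count x α + count x β

_≈ₘ_ : Multiset → Multiset → Set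
η ≈ₘ θ = ∀ x → η x ≡ θ x

-- |η₂| : number of elements of multiplicity 2 among 0,…,bound-1
-- (bound must exceed every element of η)
card₂Below : Multiset → ℕ → ℕ
card₂Below η bound = length (filter (λ x → η x ≟ 2) (upTo bound))

InB : S∞ → ℕ → ℕ → Multiset → Set
InB w k l η =
  Σ (List ℕ) λ α → Σ (List ℕ) λ α~ → Σ (List ℕ) λ β → Σ (List ℕ) λ β~ →
    InA w l α × InA w l α~ × InA w k β × InA w k β~ ×
    η ≈ₘ (α ⊕ β) × η ≈ₘ (α~ ⊕ β~) ×
    α ≢ α~ × α ≢ β~ × β ≢ α~ × β ≢ β~

{-# OPTIONS --safe #-}
module Submission where

-- Sets are identified with their 0/1 multiplicity functions; a strictly increasing sequence γ of m
-- positive integers lies in A_m(w) iff, for every t, γ has at least as many entries below t as w^m.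
-- Let d = |α∩β| = |η₂|, so that k = d + |β∖α| and l = d + |α∖β|.
--
-- If β ⊆ α, every decomposition η = α' + β' must put all of η₂ = β into β', so β' = β and η ∉ B.
-- If k = l and |β∖α| ≤ 1, any two decompositions α₁ + β₁ and α' + β' of η satisfy
-- |α'∖α₁| + |α'∖β₁| ≤ l − d ≤ 1, so α' is α₁ or β₁, and again η ∉ B.
--
-- Otherwise, exchanging a point x ∈ β∖α with a point y ∈ α∖β gives the decomposition
-- (α − y + x) + (β − x + y), which differs from α and β in the four required ways unless k = l
-- and |β∖α| = 1. Take x least in β∖α; then y can be chosen as the last point of α∖β below x or
-- the first one above x: if neither keeps both sets in A_l(w) and A_k(w), counting entries below
-- suitable thresholds contradicts the fact that the number of entries of w^l beyond w^k below t
-- grows with t.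

open import Data.Nat
open import Data.Nat.Properties
open import Algebra.Properties.CommutativeSemigroup +-commutativeSemigroup using (interchange)
open import Data.Nat.ListAction using (sum)
open import Data.List using (List; []; _∷_; [_]; length; filter; map; upTo; applyUpTo; _++_)
open import Data.List.Properties
  using (applyUpTo-∷ʳ; filter-++; length-++; filter-all; filter-none; map-upTo; length-map; length-upTo)
open import Data.List.Membership.Propositional using (_∈_; _∉_)
open import Data.List.Membership.Propositional.Properties using (∈-filter⁺; ∈-filter⁻; ∈-upTo⁺; ∈-upTo⁻)
open import Data.List.Relation.Unary.All as All using (All; []; _∷_)
open import Data.List.Relation.Unary.All.Properties using (++⁻ˡ; ++⁻ʳ)
open import Data.List.Relation.Unary.AllPairs as AllPairs using ()
open import Data.List.Relation.Unary.Any using (here; there)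
open import Data.List.Relation.Unary.Linked as Linked using (Linked)
open import Data.List.Relation.Unary.Linked.Properties using (Linked⇒AllPairs; applyUpTo⁺₂; filter⁺)
open import Data.List.Relation.Binary.Permutation.Propositional.Properties using (↭-length; filter-↭)
open import Data.List.Relation.Binary.Pointwise using (Pointwise; []; _∷_)
open import Data.List.Relation.Binary.Subset.Propositional using (_⊆_)
open import Data.List.Sort.InsertionSort.Properties ≤-decTotalOrder using (sort-↭; sort-↗)
open import Data.Product using (∃-syntax; _×_; _,_; proj₁; proj₂)
open import Data.Sum as Sum using (_⊎_; inj₁; inj₂)
open import Function using (_∘_)
open import Function.Bundles using (_⇔_; mk⇔; Equivalence)
open import Function.Construct.Composition using (_⇔-∘_)
open import Function.Construct.Symmetry using (⇔-sym)
open import Level using (0ℓ)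
open import Relation.Nullary using (¬_; Dec; yes; no; contradiction; _×-dec_)
open import Relation.Unary using (Pred; Decidable)
open import Relation.Binary using (Rel; Transitive)
open import Relation.Binary.PropositionalEquality hiding ([_])
open import Defs

𝟙 : ∀ {A : Set} → Dec A → ℕ
𝟙 (yes _) = 1
𝟙 (no _)  = 0

𝟙-yes : ∀ {A : Set} (d : Dec A) → A → 𝟙 d ≡ 1
𝟙-yes (yes _) _ = refl
𝟙-yes (no ¬a) a = contradiction a ¬a

𝟙-no : ∀ {A : Set} (d : Dec A) → ¬ A → 𝟙 d ≡ 0
𝟙-no (yes a) ¬a = contradiction a ¬a
𝟙-no (no _)  _  = refl

𝟙≤1 : ∀ {A : Set} (d : Dec A) → 𝟙 d ≤ 1
𝟙≤1 (yes _) = ≤-refl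
𝟙≤1 (no _)  = z≤n

𝟙-<?-mono : ∀ x {s t} → s ≤ t → 𝟙 (x <? s) ≤ 𝟙 (x <? t)
𝟙-<?-mono x {s} {t} s≤t with x <? s | x <? t
... | yes x<s | no x≮t = contradiction (<-≤-trans x<s s≤t) x≮t
... | yes _   | yes _  = ≤-refl
... | no _    | _      = z≤n

0<m∸n⇒n<m : ∀ {m n} → 0 < m ∸ n → n < m
0<m∸n⇒n<m pos = m∸n≢0⇒n<m (λ eq → <⇒≢ pos (sym eq))

m<n≤1⇒m≡0 : ∀ {m n} → n ≤ 1 → m < n → m ≡ 0
m<n≤1⇒m≡0 n≤1 m<n = n<1⇒n≡0 (<-≤-trans m<n n≤1)

m<n≤1⇒n≡1 : ∀ {m n} → n ≤ 1 → m < n → n ≡ 1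
m<n≤1⇒n≡1 n≤1 m<n = ≤-antisym n≤1 (≤-trans (s≤s z≤n) m<n)

m+n≤1⇒m≡0∨n≡0 : ∀ {m n} → m + n ≤ 1 → m ≡ 0 ⊎ n ≡ 0
m+n≤1⇒m≡0∨n≡0 {zero}          _         = inj₁ refl
m+n≤1⇒m≡0∨n≡0 {suc m} {zero}  _         = inj₂ refl
m+n≤1⇒m≡0∨n≡0 {suc m} {suc n} (s≤s le)  = contradiction (subst (_≤ 0) (+-suc m n) le) λ ()

bits-ext : ∀ {p q} → p ≤ 1 → q ≤ 1 → (0 < p → 0 < q) → (0 < q → 0 < p) → p ≡ q
bits-ext z≤n       z≤n       _   _   = refl
bits-ext (s≤s z≤n) (s≤s z≤n) _   _   = refl
bits-ext z≤n       (s≤s z≤n) _   q⇒p = contradiction (q⇒p (s≤s z≤n)) (n≮n 0)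
bits-ext (s≤s z≤n) z≤n       p⇒q _   = contradiction (p⇒q (s≤s z≤n)) (n≮n 0)

𝟙[+≟2]≡⊓ : ∀ {p q} → p ≤ 1 → q ≤ 1 → 𝟙 (p + q ≟ 2) ≡ p ⊓ q
𝟙[+≟2]≡⊓ z≤n       z≤n       = refl
𝟙[+≟2]≡⊓ z≤n       (s≤s z≤n) = refl
𝟙[+≟2]≡⊓ (s≤s z≤n) z≤n       = refl
𝟙[+≟2]≡⊓ (s≤s z≤n) (s≤s z≤n) = refl

excess-bits : ∀ {p q r s} → p ≤ 1 → q ≤ 1 → r ≤ 1 → s ≤ 1 → p + q ≡ r + s → (r ∸ p) + (r ∸ q) + p ⊓ q ≤ r
excess-bits z≤n       z≤n       z≤n       _         _  = z≤n
excess-bits z≤n       z≤n       (s≤s z≤n) _         ()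
excess-bits z≤n       (s≤s z≤n) z≤n       _         _  = z≤n
excess-bits z≤n       (s≤s z≤n) (s≤s z≤n) _         _  = ≤-refl
excess-bits (s≤s z≤n) z≤n       z≤n       _         _  = z≤n
excess-bits (s≤s z≤n) z≤n       (s≤s z≤n) _         _  = ≤-refl
excess-bits (s≤s z≤n) (s≤s z≤n) z≤n       z≤n       ()
excess-bits (s≤s z≤n) (s≤s z≤n) z≤n       (s≤s z≤n) ()
excess-bits (s≤s z≤n) (s≤s z≤n) (s≤s z≤n) _         _  = ≤-refl

sumBelow : (ℕ → ℕ) → ℕ → ℕ
sumBelow f zero    = 0
sumBelow f (suc n) = sumBelow f n + f n

module _ {f g : ℕ → ℕ} where

  sumBelow-cong : ∀ n → (∀ {z} → z < n → f z ≡ g z) → sumBelow f n ≡ sumBelow g n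
  sumBelow-cong zero    eq = refl
  sumBelow-cong (suc n) eq = cong₂ _+_ (sumBelow-cong n (λ z<n → eq (m<n⇒m<1+n z<n))) (eq ≤-refl)

  sumBelow-mono : ∀ n → (∀ {z} → z < n → f z ≤ g z) → sumBelow f n ≤ sumBelow g n
  sumBelow-mono zero    le = z≤n
  sumBelow-mono (suc n) le = +-mono-≤ (sumBelow-mono n (λ z<n → le (m<n⇒m<1+n z<n))) (le ≤-refl)

  sumBelow-+ : ∀ n → sumBelow (λ z → f z + g z) n ≡ sumBelow f n + sumBelow g n
  sumBelow-+ zero    = refl
  sumBelow-+ (suc n) = trans (cong (_+ (f n + g n)) (sumBelow-+ n))
                             (interchange (sumBelow f n) (sumBelow g n) (f n) (g n))

  sumBelow-≤-≡ : ∀ {n} → (∀ {z} → z < n → f z ≤ g z) → sumBelow g n ≤ sumBelow f n →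
                 ∀ {z} → z < n → f z ≡ g z
  sumBelow-≤-≡ {suc n} le sum≤ z<1+n with m≤n⇒m<n∨m≡n (≤-pred z<1+n)
  ... | inj₁ z<n  = sumBelow-≤-≡ (λ z<n → le (m<n⇒m<1+n z<n)) prefix≤ z<n
    where
    prefix≤ : sumBelow g n ≤ sumBelow f n
    prefix≤ = +-cancelʳ-≤ (g n) _ _ (≤-trans sum≤ (+-monoʳ-≤ (sumBelow f n) (le ≤-refl)))
  ... | inj₂ refl = ≤-antisym (le ≤-refl)
      (+-cancelˡ-≤ (sumBelow g n) _ _
        (≤-trans sum≤ (+-monoˡ-≤ (f n) (sumBelow-mono n (λ z<n → le (m<n⇒m<1+n z<n))))))

sumBelow-zero : ∀ (f : ℕ → ℕ) n → (∀ {z} → z < n → f z ≡ 0) → sumBelow f n ≡ 0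
sumBelow-zero f zero    _  = refl
sumBelow-zero f (suc n) eq = cong₂ _+_ (sumBelow-zero f n (λ z<n → eq (m<n⇒m<1+n z<n))) (eq ≤-refl)

sumBelow-monoʳ : ∀ (f : ℕ → ℕ) {m n} → m ≤ n → sumBelow f m ≤ sumBelow f n
sumBelow-monoʳ f {n = zero}  z≤n = ≤-refl
sumBelow-monoʳ f {n = suc n} m≤1+n with m≤n⇒m<n∨m≡n m≤1+n
... | inj₁ m<1+n = ≤-trans (sumBelow-monoʳ f (≤-pred m<1+n)) (m≤m+n (sumBelow f n) (f n))
... | inj₂ refl  = ≤-refl

≤-sumBelow : ∀ (f : ℕ → ℕ) {z n} → z < n → f z ≤ sumBelow f n
≤-sumBelow f {z} z<n = ≤-trans (m≤n+m (f z) (sumBelow f z)) (sumBelow-monoʳ f z<n)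

sumBelow≡0⇒ : ∀ (f : ℕ → ℕ) {z n} → sumBelow f n ≡ 0 → z < n → f z ≡ 0
sumBelow≡0⇒ f eq z<n = n≤0⇒n≡0 (subst (_ ≤_) eq (≤-sumBelow f z<n))

sumBelow-split : ∀ (f : ℕ → ℕ) m n → sumBelow f (m + n) ≡ sumBelow f m + sumBelow (λ i → f (m + i)) n
sumBelow-split f m zero    = trans (cong (sumBelow f) (+-identityʳ m)) (sym (+-identityʳ _))
sumBelow-split f m (suc n) rewrite +-suc m n =
  trans (cong (_+ f (m + n)) (sumBelow-split f m n)) (+-assoc (sumBelow f m) _ _)

sumBelow-bits : ∀ (f : ℕ → ℕ) {n} → (∀ i → f i ≤ 1) → sumBelow f n ≤ n
sumBelow-bits f {zero}  _   = z≤n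
sumBelow-bits f {suc n} f≤1 = subst (sumBelow f (suc n) ≤_) (+-comm n 1) (+-mono-≤ (sumBelow-bits f f≤1) (f≤1 n))

sumBelow-point : ∀ y n → sumBelow (λ z → 𝟙 (y ≟ z)) n ≡ 𝟙 (y <? n)
sumBelow-point y zero    = refl
sumBelow-point y (suc n) with y ≟ n
... | yes refl = cong₂ _+_ (trans (sumBelow-point y y) (𝟙-no (y <? y) (n≮n y))) (sym (𝟙-yes (y <? suc y) ≤-refl))
... | no  y≢n  = trans (+-identityʳ _) (trans (sumBelow-point y n) (below≡below+1 (y <? n) (y <? suc n)))
  where
  below≡below+1 : (p : Dec (y < n)) (q : Dec (y < suc n)) → 𝟙 p ≡ 𝟙 q
  below≡below+1 (yes _)   (yes _)     = refl
  below≡below+1 (no y≮n)  (no _)      = refl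
  below≡below+1 (yes y<n) (no y≮1+n)  = contradiction (m<n⇒m<1+n y<n) y≮1+n
  below≡below+1 (no y≮n)  (yes y<1+n) = contradiction (≤∧≢⇒< (≤-pred y<1+n) y≢n) y≮n

sumBelow-⊓+∸ : ∀ (p q : ℕ → ℕ) n → sumBelow (λ z → p z ⊓ q z) n + sumBelow (λ z → q z ∸ p z) n ≡ sumBelow q n
sumBelow-⊓+∸ p q n = trans (sym (sumBelow-+ n)) (sumBelow-cong n (λ {z} _ → m⊓n+n∸m≡n (p z) (q z)))

sumBelow-excess : ∀ {p q r s : ℕ → ℕ} n → (∀ z → p z ≤ 1) → (∀ z → q z ≤ 1) → (∀ z → r z ≤ 1) → (∀ z → s z ≤ 1) →
  (∀ z → p z + q z ≡ r z + s z) →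
  sumBelow (λ z → r z ∸ p z) n + sumBelow (λ z → r z ∸ q z) n + sumBelow (λ z → p z ⊓ q z) n ≤ sumBelow r n
sumBelow-excess {p} {q} {r} {s} n p≤1 q≤1 r≤1 s≤1 p+q≡r+s = begin
  sumBelow (λ z → r z ∸ p z) n + sumBelow (λ z → r z ∸ q z) n + sumBelow (λ z → p z ⊓ q z) n
    ≡⟨ cong (_+ sumBelow (λ z → p z ⊓ q z) n) (sumBelow-+ n) ⟨
  sumBelow (λ z → (r z ∸ p z) + (r z ∸ q z)) n + sumBelow (λ z → p z ⊓ q z) n
    ≡⟨ sumBelow-+ n ⟨
  sumBelow (λ z → (r z ∸ p z) + (r z ∸ q z) + p z ⊓ q z) n
    ≤⟨ sumBelow-mono n (λ {z} _ → excess-bits (p≤1 z) (q≤1 z) (r≤1 z) (s≤1 z) (p+q≡r+s z)) ⟩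
  sumBelow r n ∎
  where open ≤-Reasoning

sumBelow-first : ∀ (h : ℕ → ℕ) {m} n → sumBelow h m < sumBelow h n →
                 ∃[ y ] m ≤ y × y < n × 1 ≤ h y × sumBelow h y ≡ sumBelow h m
sumBelow-first h zero ()
sumBelow-first h {m} (suc n) m<1+n with sumBelow h m <? sumBelow h n
... | yes m<n = let y , m≤y , y<n , hy , eq = sumBelow-first h n m<n
                in y , m≤y , m<n⇒m<1+n y<n , hy , eq
... | no  m≮n = n , m≤n , ≤-refl , 1≤hn , Sn≡Sm
  where
  m≤n : m ≤ n
  m≤n with m ≤? n
  ... | yes m≤n = m≤n
  ... | no  m≰n = contradiction (sumBelow-monoʳ h (≰⇒> m≰n)) (<⇒≱ m<1+n)
  Sn≡Sm : sumBelow h n ≡ sumBelow h m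
  Sn≡Sm = ≤-antisym (≮⇒≥ m≮n) (sumBelow-monoʳ h m≤n)
  1≤hn : 1 ≤ h n
  1≤hn = n≢0⇒n>0 λ hn≡0 → <-irrefl refl
    (subst (sumBelow h m <_) (trans (cong (sumBelow h n +_) hn≡0) (trans (+-identityʳ _) Sn≡Sm)) m<1+n)

sumBelow-last : ∀ (h : ℕ → ℕ) n → 0 < sumBelow h n →
                ∃[ y ] y < n × 1 ≤ h y × sumBelow h (suc y) ≡ sumBelow h n
sumBelow-last h (suc n) pos with h n in hn
... | suc _ = n , ≤-refl , subst (1 ≤_) (sym hn) (s≤s z≤n) , cong (sumBelow h n +_) hn
... | zero  = let y , y<n , hy , eq = sumBelow-last h n (subst (0 <_) (+-identityʳ _) pos)
              in y , m<n⇒m<1+n y<n , hy , trans eq (sym (+-identityʳ _))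

shift-bound : ∀ {h H : ℕ → ℕ} {u v} → (∀ t → h t ≤ H t) → (∀ {t} → u < t → t ≤ v → h t < H t) →
              ∀ t → h t + 𝟙 (u <? t) ≤ H t + 𝟙 (v <? t)
shift-bound {h} {H} {u} {v} h≤H strict t with u <? t | v <? t
... | yes _   | yes _   = +-monoˡ-≤ 1 (h≤H t)
... | no _    | yes _   = +-mono-≤ (h≤H t) z≤n
... | no _    | no _    = +-monoˡ-≤ 0 (h≤H t)
... | yes u<t | no v≮t  = subst₂ _≤_ (+-comm 1 (h t)) (sym (+-identityʳ (H t))) (strict u<t (≮⇒≥ v≮t))

-- Used with a, b the multiplicity functions of α and β, and f, g, r the numbers of entries below t
-- of w^k, of w^l, and of w^l beyond w^k.
module Exchange (a b f g r : ℕ → ℕ) (N : ℕ)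
  (g≡f+r : ∀ t → g t ≡ f t + r t)
  (r-mono : ∀ {s t} → s ≤ t → r s ≤ r t)
  (r+B≤A : ∀ t → r t + sumBelow b N ≤ sumBelow a N)
  (f≤B : ∀ t → f t ≤ sumBelow b t)
  (g≤A : ∀ t → g t ≤ sumBelow a t)
  where

  A B M Φ Ψ : ℕ → ℕ
  A = sumBelow a
  B = sumBelow b
  M = sumBelow (λ z → a z ⊓ b z)
  Φ = sumBelow (λ z → b z ∸ a z)
  Ψ = sumBelow (λ z → a z ∸ b z)

  A≡M+Ψ : ∀ t → A t ≡ M t + Ψ t
  A≡M+Ψ t = sym (trans (cong (_+ Ψ t) (sumBelow-cong t (λ {z} _ → ⊓-comm (a z) (b z)))) (sumBelow-⊓+∸ b a t))

  B≡M+Φ : ∀ t → B t ≡ M t + Φ t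
  B≡M+Φ t = sym (sumBelow-⊓+∸ a b t)

  balance : ∀ t → Φ N + r t ≤ Ψ N
  balance t = +-cancelˡ-≤ (M N) _ _ (begin
    M N + (Φ N + r t)  ≡⟨ sym (+-assoc (M N) (Φ N) (r t)) ⟩
    M N + Φ N + r t    ≡⟨ cong (_+ r t) (sym (B≡M+Φ N)) ⟩
    B N + r t          ≡⟨ +-comm (B N) (r t) ⟩
    r t + B N          ≤⟨ r+B≤A t ⟩
    A N                ≡⟨ A≡M+Ψ N ⟩
    M N + Ψ N          ∎)
    where open ≤-Reasoning

  f-tight⇒ : ∀ {t} → 1 ≤ Φ t → B t ≤ f t → suc (r t) ≤ Ψ t
  f-tight⇒ {t} 1≤Φ B≤f = +-cancelˡ-≤ (M t) _ _ (begin
    M t + (1 + r t)    ≤⟨ +-monoʳ-≤ (M t) (+-monoˡ-≤ (r t) 1≤Φ) ⟩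
    M t + (Φ t + r t)  ≡⟨ sym (+-assoc (M t) (Φ t) (r t)) ⟩
    M t + Φ t + r t    ≡⟨ cong (_+ r t) (sym (B≡M+Φ t)) ⟩
    B t + r t          ≤⟨ +-monoˡ-≤ (r t) B≤f ⟩
    f t + r t          ≡⟨ sym (g≡f+r t) ⟩
    g t                ≤⟨ g≤A t ⟩
    A t                ≡⟨ A≡M+Ψ t ⟩
    M t + Ψ t          ∎)
    where open ≤-Reasoning

  g-tight⇒ : ∀ {t} → Φ t ≡ 0 → A t ≤ g t → Ψ t ≤ r t
  g-tight⇒ {t} Φ≡0 A≤g = +-cancelˡ-≤ (M t) _ _ (begin
    M t + Ψ t          ≡⟨ sym (A≡M+Ψ t) ⟩
    A t                ≤⟨ A≤g ⟩
    g t                ≡⟨ g≡f+r t ⟩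
    f t + r t          ≤⟨ +-monoˡ-≤ (r t) (f≤B t) ⟩
    B t + r t          ≡⟨ cong (_+ r t) (trans (B≡M+Φ t) (trans (cong (M t +_) Φ≡0) (+-identityʳ (M t)))) ⟩
    M t + r t          ∎)
    where open ≤-Reasoning

  record ExchangePair : Set where
    field
      x y     : ℕ
      x<N     : x < N
      y<N     : y < N
      a<b     : a x < b x
      b<a     : b y < a y
      g-shift : ∀ t → g t + 𝟙 (y <? t) ≤ A t + 𝟙 (x <? t)
      f-shift : ∀ t → f t + 𝟙 (x <? t) ≤ B t + 𝟙 (y <? t)

  1≤Φ-above : ∀ {x t} → a x < b x → x < t → 1 ≤ Φ t
  1≤Φ-above a<b x<t = ≤-trans (m<n⇒0<n∸m a<b) (≤-sumBelow _ x<t)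

  f-strict-above : ∀ {x y t₀} → a x < b x → t₀ ≤ suc x → Ψ (suc x) ≤ r t₀ → Ψ y ≡ Ψ (suc x) →
                   ∀ {t} → x < t → t ≤ y → f t < B t
  f-strict-above {x} {y} {t₀} a<b t₀≤1+x Ψ≤r Ψy≡Ψ1+x {t} x<t t≤y with f t <? B t
  ... | yes f<B = f<B
  ... | no  f≮B = contradiction (begin
    suc (r t)  ≤⟨ f-tight⇒ (1≤Φ-above a<b x<t) (≮⇒≥ f≮B) ⟩
    Ψ t        ≤⟨ sumBelow-monoʳ _ t≤y ⟩
    Ψ y        ≡⟨ Ψy≡Ψ1+x ⟩
    Ψ (suc x)  ≤⟨ Ψ≤r ⟩
    r t₀       ≤⟨ r-mono (≤-trans t₀≤1+x x<t) ⟩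
    r t        ∎) (n≮n (r t))
    where open ≤-Reasoning

  pair-above : ∀ {x t₀} → x < N → a x < b x → t₀ ≤ suc x → Ψ (suc x) ≤ r t₀ → ExchangePair
  pair-above {x} {t₀} x<N a<b t₀≤1+x Ψ≤r
    with sumBelow-first (λ z → a z ∸ b z) N
           (≤-trans (s≤s Ψ≤r) (≤-trans (+-monoˡ-≤ (r t₀) (1≤Φ-above a<b x<N)) (balance t₀)))
  ... | y , x<y , y<N , 1≤ψy , Ψy≡Ψ1+x = record
    { x = x ; y = y ; x<N = x<N ; y<N = y<N ; a<b = a<b ; b<a = 0<m∸n⇒n<m 1≤ψy
    ; g-shift = shift-bound g≤A (λ y<t t≤x → contradiction (≤-trans t≤x (<⇒≤ x<y)) (<⇒≱ y<t))
    ; f-shift = shift-bound f≤B (f-strict-above a<b t₀≤1+x Ψ≤r Ψy≡Ψ1+x)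
    }

  ψ-vanishes : ∀ {x} → a x < b x → Ψ (suc x) ≡ Ψ x
  ψ-vanishes {x} a<b = trans (cong (Ψ x +_) (m≤n⇒m∸n≡0 (<⇒≤ a<b))) (+-identityʳ (Ψ x))

  -- x is the least point of b ∖ a. The last point y < x of a ∖ b is moved to x if that keeps
  -- g ≤ A; otherwise, or if there is no such y, pair-above takes the first point of a ∖ b above x.
  exchange-from : ∀ {x} → x < N → a x < b x → Φ x ≡ 0 → ExchangePair
  exchange-from {x} x<N a<b Φx≡0 with 0 <? Ψ x
  ... | no  Ψx≯0 = pair-above x<N a<b z≤n (≤-trans (≤-reflexive (ψ-vanishes a<b)) (≤-trans (≮⇒≥ Ψx≯0) z≤n))
  ... | yes Ψx>0 with sumBelow-last (λ z → a z ∸ b z) x Ψx>0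
  ...   | y , y<x , 1≤ψy , Ψ1+y≡Ψx with anyUpTo? (λ t → y <? t ×-dec A t ≤? g t) (suc x)
  ...     | yes (t₀ , t₀<1+x , y<t₀ , A≤g) = pair-above x<N a<b (<⇒≤ t₀<1+x) (begin
    Ψ (suc x)  ≡⟨ ψ-vanishes a<b ⟩
    Ψ x        ≡⟨ Ψ1+y≡Ψx ⟨
    Ψ (suc y)  ≤⟨ sumBelow-monoʳ _ y<t₀ ⟩
    Ψ t₀       ≤⟨ g-tight⇒ (n≤0⇒n≡0 (subst (Φ t₀ ≤_) Φx≡0 (sumBelow-monoʳ _ (≤-pred t₀<1+x)))) A≤g ⟩
    r t₀       ∎)
    where open ≤-Reasoning
  ...     | no ∄t₀ = record
    { x = x ; y = y ; x<N = x<N ; y<N = <-trans y<x x<N ; a<b = a<b ; b<a = 0<m∸n⇒n<m 1≤ψy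
    ; g-shift = shift-bound g≤A (λ {t} y<t t≤x → ≰⇒> (λ A≤g → ∄t₀ (t , s≤s t≤x , y<t , A≤g)))
    ; f-shift = shift-bound f≤B (λ x<t t≤y → contradiction (≤-trans t≤y (<⇒≤ y<x)) (<⇒≱ x<t))
    }

  exchange : 1 ≤ Φ N → ExchangePair
  exchange 1≤ΦN with sumBelow-first (λ z → b z ∸ a z) {0} N 1≤ΦN
  ... | x , _ , x<N , 1≤φx , Φx≡0 = exchange-from x<N (0<m∸n⇒n<m 1≤φx) Φx≡0

length-filter-∷ : ∀ {A : Set} {P : Pred A 0ℓ} (P? : Decidable P) y L →
                  length (filter P? (y ∷ L)) ≡ 𝟙 (P? y) + length (filter P? L)
length-filter-∷ P? y L with P? y
... | yes _ = refl
... | no  _ = refl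

length-filter-applyUpTo : ∀ {A : Set} {P : Pred A 0ℓ} (P? : Decidable P) (f : ℕ → A) n →
                          length (filter P? (applyUpTo f n)) ≡ sumBelow (λ i → 𝟙 (P? (f i))) n
length-filter-applyUpTo P? f zero    = refl
length-filter-applyUpTo P? f (suc n) = begin
  length (filter P? (applyUpTo f (suc n)))                  ≡⟨ cong (λ xs → length (filter P? xs)) (applyUpTo-∷ʳ f n) ⟨
  length (filter P? (applyUpTo f n ++ [ f n ]))             ≡⟨ cong length (filter-++ P? (applyUpTo f n) [ f n ]) ⟩
  length (filter P? (applyUpTo f n) ++ filter P? [ f n ])   ≡⟨ length-++ (filter P? (applyUpTo f n)) ⟩
  length (filter P? (applyUpTo f n)) + length (filter P? [ f n ])
    ≡⟨ cong₂ _+_ (length-filter-applyUpTo P? f n) (trans (length-filter-∷ P? (f n) []) (+-identityʳ _)) ⟩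
  sumBelow (λ i → 𝟙 (P? (f i))) n + 𝟙 (P? (f n))           ∎
  where open ≡-Reasoning

μ : List ℕ → ℕ → ℕ
μ L z = count z L

count-∷ : ∀ z y L → count z (y ∷ L) ≡ 𝟙 (y ≟ z) + count z L
count-∷ z = length-filter-∷ (_≟ z)

∈⇒count>0 : ∀ {z L} → z ∈ L → 0 < count z L
∈⇒count>0 {z} {y ∷ L} (here refl) rewrite count-∷ z z L | 𝟙-yes (z ≟ z) refl = s≤s z≤n
∈⇒count>0 {z} {y ∷ L} (there z∈L) rewrite count-∷ z y L = ≤-trans (∈⇒count>0 z∈L) (m≤n+m _ _)

count>0⇒∈ : ∀ {z} L → 0 < count z L → z ∈ L
count>0⇒∈ {z} (y ∷ L) pos with y ≟ z | count-∷ z y L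
... | yes refl | _  = here refl
... | no  _    | eq = there (count>0⇒∈ L (subst (0 <_) eq pos))

count-∉ : ∀ {z L} → z ∉ L → count z L ≡ 0
count-∉ {L = L} z∉L = n≤0⇒n≡0 (≮⇒≥ (λ pos → z∉L (count>0⇒∈ L pos)))

Linked-head : ∀ {A : Set} {R : Rel A 0ℓ} → Transitive R → ∀ {x xs} → Linked R (x ∷ xs) → All (R x) xs
Linked-head trans lk = AllPairs.head (Linked⇒AllPairs trans lk)

count≤1 : ∀ {z L} → Linked _<_ L → count z L ≤ 1
count≤1 {L = []} _ = z≤n
count≤1 {z} {y ∷ L} lk rewrite count-∷ z y L with y ≟ z
... | yes refl = ≤-reflexive (cong suc (count-∉ (λ y∈L → n≮n y (All.lookup (Linked-head <-trans lk) y∈L))))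
... | no  _    = count≤1 (Linked.tail lk)

strict-ext : ∀ {xs ys} → Linked _<_ xs → Linked _<_ ys → xs ⊆ ys → ys ⊆ xs → xs ≡ ys
strict-ext {[]}     {[]}     _  _  _     _     = refl
strict-ext {[]}     {y ∷ _}  _  _  _     ys⊆xs with () ← ys⊆xs (here refl)
strict-ext {x ∷ _}  {[]}     _  _  xs⊆ys _     with () ← xs⊆ys (here refl)
strict-ext {x ∷ xs} {y ∷ ys} lx ly xs⊆ys ys⊆xs with xs⊆ys (here refl) | ys⊆xs (here refl)
... | there x∈ys | there y∈xs = contradiction (All.lookup (Linked-head <-trans ly) x∈ys)
                                              (<⇒≯ (All.lookup (Linked-head <-trans lx) y∈xs))
... | here refl  | _          = cong (x ∷_) (strict-ext (Linked.tail lx) (Linked.tail ly) (drop lx xs⊆ys) (drop ly ys⊆xs))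
  where
  drop : ∀ {us vs} → Linked _<_ (x ∷ us) → x ∷ us ⊆ x ∷ vs → us ⊆ vs
  drop lu us⊆vs z∈us with us⊆vs (there z∈us)
  ... | here refl  = contradiction (All.lookup (Linked-head <-trans lu) z∈us) (n≮n x)
  ... | there z∈vs = z∈vs
... | there x∈ys | here refl  = contradiction (All.lookup (Linked-head <-trans ly) x∈ys) (n≮n x)

count-ext : ∀ {xs ys} → Linked _<_ xs → Linked _<_ ys → (∀ z → count z xs ≡ count z ys) → xs ≡ ys
count-ext {xs} {ys} lx ly eq = strict-ext lx ly
  (λ {z} z∈xs → count>0⇒∈ ys (subst (0 <_) (eq z) (∈⇒count>0 z∈xs)))
  (λ {z} z∈ys → count>0⇒∈ xs (subst (0 <_) (sym (eq z)) (∈⇒count>0 z∈ys)))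

countBelow : ℕ → List ℕ → ℕ
countBelow t L = length (filter (_<? t) L)

countBelow-∷ : ∀ t y L → countBelow t (y ∷ L) ≡ 𝟙 (y <? t) + countBelow t L
countBelow-∷ t = length-filter-∷ (_<? t)

countBelow-above : ∀ {t L} → All (t ≤_) L → countBelow t L ≡ 0
countBelow-above {t} t≤L = cong length (filter-none (_<? t) (All.map (λ t≤z z<t → <⇒≱ z<t t≤z) t≤L))

countBelow≡sumBelow : ∀ n L → countBelow n L ≡ sumBelow (μ L) n
countBelow≡sumBelow n []      = sym (sumBelow-zero (μ []) n (λ _ → refl))
countBelow≡sumBelow n (y ∷ L) = begin
  countBelow n (y ∷ L)                              ≡⟨ countBelow-∷ n y L ⟩
  𝟙 (y <? n) + countBelow n L                       ≡⟨ cong₂ _+_ (sumBelow-point y n) (sym (countBelow≡sumBelow n L)) ⟨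
  sumBelow (λ z → 𝟙 (y ≟ z)) n + sumBelow (μ L) n   ≡⟨ sumBelow-+ n ⟨
  sumBelow (λ z → 𝟙 (y ≟ z) + μ L z) n              ≡⟨ sumBelow-cong n (λ {z} _ → count-∷ z y L) ⟨
  sumBelow (μ (y ∷ L)) n                            ∎
  where open ≡-Reasoning

length≡sumBelow : ∀ {n L} → All (_< n) L → length L ≡ sumBelow (μ L) n
length≡sumBelow {n} {L} L<n = trans (cong length (sym (filter-all (_<? n) L<n))) (countBelow≡sumBelow n L)

excess≡0⇒≡ : ∀ {n L L'} → Linked _<_ L → Linked _<_ L' → All (_< n) L → All (_< n) L' →
             sumBelow (λ z → μ L' z ∸ μ L z) n ≡ 0 → length L ≤ length L' → L' ≡ L
excess≡0⇒≡ {n} {L} {L'} sL sL' L<n L'<n excess≡0 len≤ = count-ext sL' sL same-count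
  where
  L'≤L : ∀ {z} → z < n → μ L' z ≤ μ L z
  L'≤L z<n = m∸n≡0⇒m≤n (sumBelow≡0⇒ _ excess≡0 z<n)
  same-count : ∀ z → count z L' ≡ count z L
  same-count z with z <? n
  ... | yes z<n = sumBelow-≤-≡ L'≤L (subst₂ _≤_ (length≡sumBelow L<n) (length≡sumBelow L'<n) len≤) z<n
  ... | no  z≮n = trans (count-∉ (λ z∈L' → z≮n (All.lookup L'<n z∈L')))
                        (sym (count-∉ (λ z∈L → z≮n (All.lookup L<n z∈L))))

card₂Below-⊕ : ∀ {η L₁ L₂} n → η ≈ₘ (L₁ ⊕ L₂) → Linked _<_ L₁ → Linked _<_ L₂ →
               card₂Below η n ≡ sumBelow (λ z → μ L₁ z ⊓ μ L₂ z) n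
card₂Below-⊕ {η} n η≈ s₁ s₂ = trans (length-filter-applyUpTo (λ x → η x ≟ 2) (λ i → i) n)
  (sumBelow-cong n (λ {z} _ → trans (cong (λ v → 𝟙 (v ≟ 2)) (η≈ z)) (𝟙[+≟2]≡⊓ (count≤1 s₁) (count≤1 s₂))))

support : (ℕ → ℕ) → ℕ → List ℕ
support ν n = filter (λ z → 1 ≤? ν z) (upTo n)

support-strict : ∀ ν n → Linked _<_ (support ν n)
support-strict ν n = filter⁺ (λ z → 1 ≤? ν z) <-trans (applyUpTo⁺₂ (λ i → i) n n<1+n)

count-support : ∀ {ν n} → (∀ z → ν z ≤ 1) → (∀ {z} → n ≤ z → ν z ≡ 0) → ∀ z → count z (support ν n) ≡ ν z
count-support {ν} {n} ν≤1 ν-beyond z = bits-ext (count≤1 (support-strict ν n)) (ν≤1 z)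
  (λ pos → proj₂ (∈-filter⁻ (λ z → 1 ≤? ν z) {xs = upTo n} (count>0⇒∈ (support ν n) pos)))
  (λ pos → ∈⇒count>0 (∈-filter⁺ (λ z → 1 ≤? ν z) (∈-upTo⁺ (z<n pos)) pos))
  where
  z<n : 0 < ν z → z < n
  z<n pos = ≰⇒> (λ n≤z → <⇒≢ pos (sym (ν-beyond n≤z)))

All-≤-sum : ∀ L → All (_≤ sum L) L
All-≤-sum []      = []
All-≤-sum (x ∷ L) = m≤m+n x (sum L) ∷ All.map (λ y≤ → ≤-trans y≤ (m≤n+m (sum L) x)) (All-≤-sum L)

Pointwise⇒countBelow : ∀ {xs ys} → Pointwise _≤_ xs ys → ∀ t → countBelow t ys ≤ countBelow t xs
Pointwise⇒countBelow [] t = z≤n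
Pointwise⇒countBelow {x ∷ xs} {y ∷ ys} (x≤y ∷ xs≤ys) t
  rewrite countBelow-∷ t x xs | countBelow-∷ t y ys with y <? t | x <? t
... | yes _   | yes _  = s≤s (Pointwise⇒countBelow xs≤ys t)
... | yes y<t | no x≮t = contradiction (≤-<-trans x≤y y<t) x≮t
... | no _    | yes _  = m≤n⇒m≤1+n (Pointwise⇒countBelow xs≤ys t)
... | no _    | no _   = Pointwise⇒countBelow xs≤ys t

countBelow⇒Pointwise : ∀ {xs ys} → Linked _≤_ xs → Linked _≤_ ys → length xs ≡ length ys →
                       (∀ t → countBelow t ys ≤ countBelow t xs) → Pointwise _≤_ xs ys
countBelow⇒Pointwise {[]}     {[]}     _  _  _   _   = []
countBelow⇒Pointwise {x ∷ xs} {y ∷ ys} sx sy len dom =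
  x≤y ∷ countBelow⇒Pointwise (Linked.tail sx) (Linked.tail sy) (suc-injective len) dom′
  where
  x≤y : x ≤ y
  x≤y with x ≤? y
  ... | yes x≤y = x≤y
  ... | no  x≰y = contradiction (dom (suc y)) (<⇒≱ (begin-strict
    countBelow (suc y) (x ∷ xs)          ≡⟨ countBelow-above (y<x ∷ All.map (≤-trans y<x) (Linked-head ≤-trans sx)) ⟩
    0                                    <⟨ s≤s z≤n ⟩
    1 + countBelow (suc y) ys            ≡⟨ cong (_+ countBelow (suc y) ys) (𝟙-yes (y <? suc y) ≤-refl) ⟨
    𝟙 (y <? suc y) + countBelow (suc y) ys ≡⟨ countBelow-∷ (suc y) y ys ⟨
    countBelow (suc y) (y ∷ ys)          ∎))
    where
    open ≤-Reasoning
    y<x : y < x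
    y<x = ≰⇒> x≰y
  dom′ : ∀ t → countBelow t ys ≤ countBelow t xs
  dom′ t with y <? t | countBelow-∷ t y ys | countBelow-∷ t x xs
  ... | no y≮t  | _   | _   =
    ≤-trans (≤-reflexive (countBelow-above (All.map (≤-trans (≮⇒≥ y≮t)) (Linked-head ≤-trans sy)))) z≤n
  ... | yes y<t | eqy | eqx rewrite 𝟙-yes (x <? t) (≤-<-trans x≤y y<t) = ≤-pred (subst₂ _≤_ eqy eqx (dom t))

module _ (w : S∞) where

  wUpTo-sorted : ∀ m → Linked _≤_ (wUpTo w m)
  wUpTo-sorted m = sort-↗ (map (λ i → fun w (suc i)) (upTo m))

  length-wUpTo : ∀ m → length (wUpTo w m) ≡ m
  length-wUpTo m = trans (↭-length (sort-↭ (map (λ i → fun w (suc i)) (upTo m))))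
                         (trans (length-map _ (upTo m)) (length-upTo m))

  countBelow-wUpTo : ∀ m t → countBelow t (wUpTo w m) ≡ sumBelow (λ i → 𝟙 (fun w (suc i) <? t)) m
  countBelow-wUpTo m t = begin
    countBelow t (wUpTo w m)
      ≡⟨ ↭-length (filter-↭ (_<? t) (sort-↭ (map (λ i → fun w (suc i)) (upTo m)))) ⟩
    countBelow t (map (λ i → fun w (suc i)) (upTo m))      ≡⟨ cong (countBelow t) (map-upTo _ m) ⟩
    length (filter (_<? t) (applyUpTo (λ i → fun w (suc i)) m)) ≡⟨ length-filter-applyUpTo (_<? t) _ m ⟩
    sumBelow (λ i → 𝟙 (fun w (suc i) <? t)) m              ∎
    where open ≡-Reasoning

module _ (w : S∞) (k d : ℕ) where

  wBetween : ℕ → ℕ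
  wBetween t = sumBelow (λ i → 𝟙 (fun w (suc (k + i)) <? t)) d

  countBelow-wUpTo-+ : ∀ t → countBelow t (wUpTo w (k + d)) ≡ countBelow t (wUpTo w k) + wBetween t
  countBelow-wUpTo-+ t = trans (countBelow-wUpTo w (k + d) t)
    (trans (sumBelow-split _ k d) (cong (_+ wBetween t) (sym (countBelow-wUpTo w k t))))

  wBetween-mono : ∀ {s t} → s ≤ t → wBetween s ≤ wBetween t
  wBetween-mono s≤t = sumBelow-mono d (λ {i} _ → 𝟙-<?-mono (fun w (suc (k + i))) s≤t)

  wBetween≤ : ∀ t → wBetween t ≤ d
  wBetween≤ t = sumBelow-bits _ (λ i → 𝟙≤1 (fun w (suc (k + i)) <? t))

-- dominates is the counting form of the entrywise bound by w^m (see countBelow⇒Pointwise).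
record IsIndicatorInA (w : S∞) (m N : ℕ) (ν : ℕ → ℕ) : Set where
  field
    bit       : ∀ z → ν z ≤ 1
    at-zero   : ν 0 ≡ 0
    beyond    : ∀ {z} → N ≤ z → ν z ≡ 0
    size      : sumBelow ν N ≡ m
    dominates : ∀ t → countBelow t (wUpTo w m) ≤ sumBelow ν t

InA-strict : ∀ w {m L} → InA w m L → Linked _<_ L
InA-strict _ (strict , _) = strict

InA-length : ∀ w {m L} → InA w m L → length L ≡ m
InA-length _ (_ , _ , len , _) = len

InA⇒IsIndicatorInA : ∀ {w m N L} → InA w m L → All (_< N) L → IsIndicatorInA w m N (μ L)
InA⇒IsIndicatorInA {L = L} (strict , positive , len , L≤w) L<N = record
  { bit       = λ z → count≤1 strict
  ; at-zero   = count-∉ (λ 0∈L → n≮n 0 (All.lookup positive 0∈L))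
  ; beyond    = λ N≤z → count-∉ (λ z∈L → <⇒≱ (All.lookup L<N z∈L) N≤z)
  ; size      = trans (sym (length≡sumBelow L<N)) len
  ; dominates = λ t → subst (_ ≤_) (countBelow≡sumBelow t L) (Pointwise⇒countBelow L≤w t)
  }

IsIndicatorInA⇒InA : ∀ {w m N ν} → IsIndicatorInA w m N ν → InA w m (support ν N)
IsIndicatorInA⇒InA {w} {m} {N} {ν} I = strict , positive , len , L≤w
  where
  open IsIndicatorInA I
  L : List ℕ
  L = support ν N
  strict : Linked _<_ L
  strict = support-strict ν N
  μL≡ν : ∀ z → μ L z ≡ ν z
  μL≡ν = count-support bit beyond
  positive : All Positive L
  positive = All.tabulate λ {z} z∈L → nonzero z (proj₂ (∈-filter⁻ (λ z → 1 ≤? ν z) {xs = upTo N} z∈L))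
    where
    nonzero : ∀ z → 1 ≤ ν z → 1 ≤ z
    nonzero zero    pos = contradiction (subst (1 ≤_) at-zero pos) (n≮n 0)
    nonzero (suc z) _   = s≤s z≤n
  len : length L ≡ m
  len = trans (length≡sumBelow
                (All.tabulate (λ z∈L → ∈-upTo⁻ (proj₁ (∈-filter⁻ (λ z → 1 ≤? ν z) {xs = upTo N} z∈L)))))
              (trans (sumBelow-cong N (λ {z} _ → μL≡ν z)) size)
  L≤w : Pointwise _≤_ L (wUpTo w m)
  L≤w = countBelow⇒Pointwise (Linked.map <⇒≤ strict) (wUpTo-sorted w m) (trans len (sym (length-wUpTo w m)))
    (λ t → subst (_ ≤_) (trans (sumBelow-cong t (λ {z} _ → sym (μL≡ν z))) (sym (countBelow≡sumBelow t L)))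
                 (dominates t))

move : (ℕ → ℕ) → ℕ → ℕ → ℕ → ℕ
move ν i o z = (ν z + 𝟙 (o ≟ z)) ∸ 𝟙 (i ≟ z)

module _ (ν : ℕ → ℕ) (i o : ℕ) where

  move-+ : ν i ≡ 1 → ∀ z → move ν i o z + 𝟙 (i ≟ z) ≡ ν z + 𝟙 (o ≟ z)
  move-+ νi≡1 z = m∸n+n≡m (removable (i ≟ z))
    where
    removable : (d : Dec (i ≡ z)) → 𝟙 d ≤ ν z + 𝟙 (o ≟ z)
    removable (yes refl) = ≤-trans (≤-reflexive (sym νi≡1)) (m≤m+n (ν i) _)
    removable (no _)     = z≤n

  move-bit : (∀ z → ν z ≤ 1) → ν o ≡ 0 → ∀ z → move ν i o z ≤ 1
  move-bit ν≤1 νo≡0 z = ≤-trans (m∸n≤m _ (𝟙 (i ≟ z))) (added (o ≟ z))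
    where
    added : (d : Dec (o ≡ z)) → ν z + 𝟙 d ≤ 1
    added (yes refl) = ≤-reflexive (cong (_+ 1) νo≡0)
    added (no _)     = ≤-trans (≤-reflexive (+-identityʳ (ν z))) (ν≤1 z)

  move-vanish : ∀ {z} → ν z ≡ 0 → o ≢ z → move ν i o z ≡ 0
  move-vanish {z} νz≡0 o≢z rewrite νz≡0 | 𝟙-no (o ≟ z) o≢z = 0∸n≡0 (𝟙 (i ≟ z))

  move-at-i : ν i ≡ 1 → o ≢ i → move ν i o i ≡ 0
  move-at-i νi≡1 o≢i rewrite νi≡1 | 𝟙-no (o ≟ i) o≢i | 𝟙-yes (i ≟ i) refl = refl

  move-at-o : ν o ≡ 0 → i ≢ o → move ν i o o ≡ 1
  move-at-o νo≡0 i≢o rewrite νo≡0 | 𝟙-yes (o ≟ o) refl | 𝟙-no (i ≟ o) i≢o = refl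

  move-deficit : ν i ≡ 1 → ∀ z → ν z ∸ move ν i o z ≤ 𝟙 (i ≟ z)
  move-deficit νi≡1 z = m≤n+o⇒m∸n≤o (ν z) (move ν i o z)
    (≤-trans (m≤m+n (ν z) _) (≤-reflexive (sym (move-+ νi≡1 z))))

  sumBelow-move : ν i ≡ 1 → ∀ t → sumBelow (move ν i o) t + 𝟙 (i <? t) ≡ sumBelow ν t + 𝟙 (o <? t)
  sumBelow-move νi≡1 t = begin
    sumBelow (move ν i o) t + 𝟙 (i <? t)                     ≡⟨ cong (sumBelow (move ν i o) t +_) (sumBelow-point i t) ⟨
    sumBelow (move ν i o) t + sumBelow (λ z → 𝟙 (i ≟ z)) t   ≡⟨ sumBelow-+ t ⟨
    sumBelow (λ z → move ν i o z + 𝟙 (i ≟ z)) t              ≡⟨ sumBelow-cong t (λ {z} _ → move-+ νi≡1 z) ⟩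
    sumBelow (λ z → ν z + 𝟙 (o ≟ z)) t                       ≡⟨ sumBelow-+ t ⟩
    sumBelow ν t + sumBelow (λ z → 𝟙 (o ≟ z)) t              ≡⟨ cong (sumBelow ν t +_) (sumBelow-point o t) ⟩
    sumBelow ν t + 𝟙 (o <? t)                                ∎
    where open ≡-Reasoning

move-pair : ∀ ν ρ i o → ν i ≡ 1 → ρ o ≡ 1 → ∀ z → move ν i o z + move ρ o i z ≡ ν z + ρ z
move-pair ν ρ i o νi≡1 ρo≡1 z = +-cancelʳ-≡ (𝟙 (i ≟ z) + 𝟙 (o ≟ z)) _ _ (begin
  move ν i o z + move ρ o i z + (𝟙 (i ≟ z) + 𝟙 (o ≟ z))   ≡⟨ interchange (move ν i o z) _ (𝟙 (i ≟ z)) _ ⟩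
  (move ν i o z + 𝟙 (i ≟ z)) + (move ρ o i z + 𝟙 (o ≟ z)) ≡⟨ cong₂ _+_ (move-+ ν i o νi≡1 z) (move-+ ρ o i ρo≡1 z) ⟩
  (ν z + 𝟙 (o ≟ z)) + (ρ z + 𝟙 (i ≟ z))                   ≡⟨ interchange (ν z) _ (ρ z) _ ⟩
  ν z + ρ z + (𝟙 (o ≟ z) + 𝟙 (i ≟ z))                     ≡⟨ cong (ν z + ρ z +_) (+-comm (𝟙 (o ≟ z)) _) ⟩
  ν z + ρ z + (𝟙 (i ≟ z) + 𝟙 (o ≟ z))                     ∎)
  where open ≡-Reasoning

sumBelow-∸-move : ∀ ν i o n → ν i ≡ 1 → sumBelow (λ z → ν z ∸ move ν i o z) n ≤ 1
sumBelow-∸-move ν i o n νi≡1 = ≤-trans (sumBelow-mono n (λ {z} _ → move-deficit ν i o νi≡1 z))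
  (≤-trans (≤-reflexive (sumBelow-point i n)) (𝟙≤1 (i <? n)))

IsIndicatorInA-move : ∀ {w m N ν i o} → IsIndicatorInA w m N ν → ν i ≡ 1 → ν o ≡ 0 → 0 < o → o < N →
  (∀ t → countBelow t (wUpTo w m) + 𝟙 (i <? t) ≤ sumBelow ν t + 𝟙 (o <? t)) →
  IsIndicatorInA w m N (move ν i o)
IsIndicatorInA-move {w} {m} {N} {ν} {i} {o} I νi≡1 νo≡0 0<o o<N shifted = record
  { bit       = move-bit ν i o bit νo≡0
  ; at-zero   = move-vanish ν i o at-zero (>⇒≢ 0<o)
  ; beyond    = λ N≤z → move-vanish ν i o (beyond N≤z) (<⇒≢ (<-≤-trans o<N N≤z))
  ; size      = trans (+-cancelʳ-≡ 1 _ _ (begin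
      sumBelow (move ν i o) N + 1           ≡⟨ cong (sumBelow (move ν i o) N +_) (𝟙-yes (i <? N) i<N) ⟨
      sumBelow (move ν i o) N + 𝟙 (i <? N)  ≡⟨ sumBelow-move ν i o νi≡1 N ⟩
      sumBelow ν N + 𝟙 (o <? N)             ≡⟨ cong (sumBelow ν N +_) (𝟙-yes (o <? N) o<N) ⟩
      sumBelow ν N + 1                      ∎)) size
  ; dominates = λ t → +-cancelʳ-≤ (𝟙 (i <? t)) _ _
      (≤-trans (shifted t) (≤-reflexive (sym (sumBelow-move ν i o νi≡1 t))))
  }
  where
  open IsIndicatorInA I
  open ≡-Reasoning
  i<N : i < N
  i<N = ≰⇒> (λ N≤i → <⇒≢ (s≤s z≤n) (sym (trans (sym νi≡1) (beyond N≤i))))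

module Decompositions (w : S∞) (k l : ℕ) (k≤l : k ≤ l) (α β : List ℕ) (Aα : InA w l α) (Aβ : InA w k β) where

  N : ℕ
  N = suc (sum (α ++ β))

  η : Multiset
  η = α ⊕ β

  a b : ℕ → ℕ
  a = μ α
  b = μ β

  α<N : All (_< N) α
  α<N = ++⁻ˡ α (All.map s≤s (All-≤-sum (α ++ β)))

  β<N : All (_< N) β
  β<N = ++⁻ʳ α (All.map s≤s (All-≤-sum (α ++ β)))

  Ia : IsIndicatorInA w l N a
  Ia = InA⇒IsIndicatorInA Aα α<N

  Ib : IsIndicatorInA w k N b
  Ib = InA⇒IsIndicatorInA Aβ β<N

  open IsIndicatorInA

  #α∩β #α∖β #β∖α : ℕ
  #α∩β = sumBelow (λ z → a z ⊓ b z) N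
  #α∖β = sumBelow (λ z → a z ∸ b z) N
  #β∖α = sumBelow (λ z → b z ∸ a z) N

  η₂≡#α∩β : card₂Below η N ≡ #α∩β
  η₂≡#α∩β = card₂Below-⊕ N (λ _ → refl) (InA-strict w Aα) (InA-strict w Aβ)

  k≡#α∩β+#β∖α : k ≡ #α∩β + #β∖α
  k≡#α∩β+#β∖α = trans (sym (size Ib)) (sym (sumBelow-⊓+∸ a b N))

  l≡#α∩β+#α∖β : l ≡ #α∩β + #α∖β
  l≡#α∩β+#α∖β = trans (sym (size Ia)) (sym (trans (cong (_+ #α∖β) #α∩β-comm) (sumBelow-⊓+∸ b a N)))
    where
    #α∩β-comm : #α∩β ≡ sumBelow (λ z → b z ⊓ a z) N
    #α∩β-comm = sumBelow-cong N (λ {z} _ → ⊓-comm (a z) (b z))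

  k≡η₂+#β∖α : k ≡ card₂Below η N + #β∖α
  k≡η₂+#β∖α = trans k≡#α∩β+#β∖α (cong (_+ #β∖α) (sym η₂≡#α∩β))

  #α∖β≡#β∖α : k ≡ l → #α∖β ≡ #β∖α
  #α∖β≡#β∖α k≡l = +-cancelˡ-≡ #α∩β _ _ (trans (sym l≡#α∩β+#α∖β) (trans (sym k≡l) k≡#α∩β+#β∖α))

  ⊆⇔#β∖α≡0 : β ⊆ α ⇔ #β∖α ≡ 0
  ⊆⇔#β∖α≡0 = mk⇔ to from
    where
    to : β ⊆ α → #β∖α ≡ 0
    to β⊆α = sumBelow-zero _ N (λ {z} _ → m≤n⇒m∸n≡0 (b≤a z))
      where
      b≤a : ∀ z → b z ≤ a z
      b≤a z with 0 <? b z
      ... | yes 0<bz = ≤-trans (bit Ib z) (∈⇒count>0 (β⊆α (count>0⇒∈ β 0<bz)))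
      ... | no  0≮bz = ≤-trans (≮⇒≥ 0≮bz) z≤n
    from : #β∖α ≡ 0 → β ⊆ α
    from #β∖α≡0 {z} z∈β = count>0⇒∈ α (≤-trans (∈⇒count>0 z∈β) (m∸n≡0⇒m≤n (sumBelow≡0⇒ _ #β∖α≡0 z<N)))
      where
      z<N : z < N
      z<N = ≰⇒> (λ N≤z → <⇒≢ (∈⇒count>0 z∈β) (sym (beyond Ib N≤z)))

  k≡η₂⇔#β∖α≡0 : (k ≡ card₂Below η N) ⇔ #β∖α ≡ 0
  k≡η₂⇔#β∖α≡0 = mk⇔
    (λ k≡η₂ → +-cancelˡ-≡ (card₂Below η N) _ _ (trans (sym k≡η₂+#β∖α) (trans k≡η₂ (sym (+-identityʳ _)))))
    (λ #β∖α≡0 → trans k≡η₂+#β∖α (trans (cong (card₂Below η N +_) #β∖α≡0) (+-identityʳ _)))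

  k≡η₂⊎k≡1+η₂⇔#β∖α≤1 : (k ≡ card₂Below η N ⊎ k ≡ suc (card₂Below η N)) ⇔ #β∖α ≤ 1
  k≡η₂⊎k≡1+η₂⇔#β∖α≤1 = mk⇔ to from
    where
    η₂ : ℕ
    η₂ = card₂Below η N
    to : k ≡ η₂ ⊎ k ≡ suc η₂ → #β∖α ≤ 1
    to (inj₁ k≡η₂)   = ≤-trans (≤-reflexive (Equivalence.to k≡η₂⇔#β∖α≡0 k≡η₂)) z≤n
    to (inj₂ k≡1+η₂) = ≤-reflexive (+-cancelˡ-≡ η₂ _ _ (trans (sym k≡η₂+#β∖α) (trans k≡1+η₂ (+-comm 1 η₂))))
    from : #β∖α ≤ 1 → k ≡ η₂ ⊎ k ≡ suc η₂
    from #β∖α≤1 with n≤1⇒n≡0∨n≡1 #β∖α≤1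
    ... | inj₁ #β∖α≡0 = inj₁ (Equivalence.from k≡η₂⇔#β∖α≡0 #β∖α≡0)
    ... | inj₂ #β∖α≡1 = inj₂ (trans k≡η₂+#β∖α (trans (cong (η₂ +_) #β∖α≡1) (+-comm η₂ 1)))

  components-bounded : ∀ {α' β'} → η ≈ₘ (α' ⊕ β') → All (_< N) α' × All (_< N) β'
  components-bounded {α'} {β'} η≈ = All.tabulate (λ z∈α' → below (≤-trans (∈⇒count>0 z∈α') (m≤m+n _ _)))
                                  , All.tabulate (λ z∈β' → below (≤-trans (∈⇒count>0 z∈β') (m≤n+m _ _)))
    where
    below : ∀ {z} → 0 < count z α' + count z β' → z < N
    below {z} pos = ≰⇒> λ N≤z → <⇒≢ pos (sym (trans (sym (η≈ z)) (cong₂ _+_ (beyond Ia N≤z) (beyond Ib N≤z))))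

  β-determined : #β∖α ≡ 0 → ∀ {α' β'} → InA w l α' → InA w k β' → η ≈ₘ (α' ⊕ β') → β' ≡ β
  β-determined #β∖α≡0 {α'} {β'} Aα' Aβ' η≈ =
    excess≡0⇒≡ (InA-strict w Aβ) (InA-strict w Aβ') β<N β'<N excess≡0
      (≤-reflexive (trans (InA-length w Aβ) (sym (InA-length w Aβ'))))
    where
    β'<N : All (_< N) β'
    β'<N = proj₂ (components-bounded {α'} η≈)
    Ib' : IsIndicatorInA w k N (μ β')
    Ib' = InA⇒IsIndicatorInA Aβ' β'<N
    excess≡0 : sumBelow (λ z → μ β' z ∸ b z) N ≡ 0
    excess≡0 = n≤0⇒n≡0 (+-cancelʳ-≤ #α∩β _ _ (begin
      sumBelow (λ z → μ β' z ∸ b z) N + #α∩β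
        ≤⟨ +-monoˡ-≤ #α∩β (m≤n+m _ (sumBelow (λ z → μ β' z ∸ a z) N)) ⟩
      sumBelow (λ z → μ β' z ∸ a z) N + sumBelow (λ z → μ β' z ∸ b z) N + #α∩β
        ≤⟨ sumBelow-excess {a} {b} {μ β'} {μ α'} N (bit Ia) (bit Ib) (bit Ib') (λ z → count≤1 (InA-strict w Aα'))
             (λ z → trans (η≈ z) (+-comm (μ α' z) (μ β' z))) ⟩
      sumBelow (μ β') N  ≡⟨ size Ib' ⟩
      k                  ≡⟨ k≡#α∩β+#β∖α ⟩
      #α∩β + #β∖α        ≡⟨ cong (#α∩β +_) #β∖α≡0 ⟩
      #α∩β + 0           ≡⟨ +-comm #α∩β 0 ⟩
      0 + #α∩β           ∎))
      where open ≤-Reasoning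

  balanced-components : k ≡ l → #β∖α ≤ 1 →
    ∀ {α₁ β₁ α₂ β₂} → InA w l α₁ → InA w k β₁ → InA w l α₂ → InA w k β₂ →
    η ≈ₘ (α₁ ⊕ β₁) → η ≈ₘ (α₂ ⊕ β₂) → α₂ ≡ α₁ ⊎ α₂ ≡ β₁
  balanced-components k≡l #β∖α≤1 {α₁} {β₁} {α₂} {β₂} A₁ B₁ A₂ B₂ η≈₁ η≈₂ =
    Sum.map (λ P≡0  → excess≡0⇒≡ (InA-strict w A₁) (InA-strict w A₂) α₁<N α₂<N P≡0
                        (≤-reflexive (trans (InA-length w A₁) (sym (InA-length w A₂)))))
            (λ P'≡0 → excess≡0⇒≡ (InA-strict w B₁) (InA-strict w A₂) β₁<N α₂<N P'≡0
                        (≤-trans (≤-reflexive (InA-length w B₁)) (≤-trans k≤l (≤-reflexive (sym (InA-length w A₂))))))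
            (m+n≤1⇒m≡0∨n≡0 excess≤1)
    where
    α₁<N : All (_< N) α₁
    α₁<N = proj₁ (components-bounded {α₁} {β₁} η≈₁)
    β₁<N : All (_< N) β₁
    β₁<N = proj₂ (components-bounded {α₁} {β₁} η≈₁)
    α₂<N : All (_< N) α₂
    α₂<N = proj₁ (components-bounded {α₂} {β₂} η≈₂)
    P P' : ℕ
    P  = sumBelow (λ z → μ α₂ z ∸ μ α₁ z) N
    P' = sumBelow (λ z → μ α₂ z ∸ μ β₁ z) N
    bits : ∀ {m L} → InA w m L → ∀ z → μ L z ≤ 1
    bits A z = count≤1 (InA-strict w A)
    excess≤1 : P + P' ≤ 1
    excess≤1 = +-cancelʳ-≤ #α∩β _ _ (begin
      P + P' + #α∩β
        ≡⟨ cong (P + P' +_) (trans (sym η₂≡#α∩β) (card₂Below-⊕ N η≈₁ (InA-strict w A₁) (InA-strict w B₁))) ⟩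
      P + P' + sumBelow (λ z → μ α₁ z ⊓ μ β₁ z) N
        ≤⟨ sumBelow-excess {μ α₁} {μ β₁} {μ α₂} {μ β₂} N (bits A₁) (bits B₁) (bits A₂) (bits B₂)
             (λ z → trans (sym (η≈₁ z)) (η≈₂ z)) ⟩
      sumBelow (μ α₂) N  ≡⟨ size (InA⇒IsIndicatorInA {w} A₂ α₂<N) ⟩
      l                  ≡⟨ l≡#α∩β+#α∖β ⟩
      #α∩β + #α∖β        ≤⟨ +-monoʳ-≤ #α∩β (≤-trans (≤-reflexive (#α∖β≡#β∖α k≡l)) #β∖α≤1) ⟩
      #α∩β + 1           ≡⟨ +-comm #α∩β 1 ⟩
      1 + #α∩β           ∎)
      where open ≤-Reasoning

  #β∖α≡0⇒¬InB : #β∖α ≡ 0 → ¬ InB w k l η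
  #β∖α≡0⇒¬InB #β∖α≡0 (_ , _ , _ , _ , A₁ , A₂ , B₁ , B₂ , η≈₁ , η≈₂ , _ , _ , _ , β₁≢β₂) =
    β₁≢β₂ (trans (β-determined #β∖α≡0 A₁ B₁ η≈₁) (sym (β-determined #β∖α≡0 A₂ B₂ η≈₂)))

  balanced⇒¬InB : k ≡ l → #β∖α ≤ 1 → ¬ InB w k l η
  balanced⇒¬InB k≡l #β∖α≤1 (_ , _ , _ , _ , A₁ , A₂ , B₁ , B₂ , η≈₁ , η≈₂ , α₁≢α₂ , _ , β₁≢α₂ , _)
    with balanced-components k≡l #β∖α≤1 A₁ B₁ A₂ B₂ η≈₁ η≈₂
  ... | inj₁ α₂≡α₁ = α₁≢α₂ (sym α₂≡α₁)
  ... | inj₂ α₂≡β₁ = β₁≢α₂ (sym α₂≡β₁)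

  f g r : ℕ → ℕ
  f t = countBelow t (wUpTo w k)
  g t = countBelow t (wUpTo w l)
  r = wBetween w k (l ∸ k)

  g≡f+r : ∀ t → g t ≡ f t + r t
  g≡f+r t = trans (cong (λ m → countBelow t (wUpTo w m)) (sym (m+[n∸m]≡n k≤l))) (countBelow-wUpTo-+ w k (l ∸ k) t)

  r+B≤A : ∀ t → r t + sumBelow b N ≤ sumBelow a N
  r+B≤A t = subst₂ (λ B A → r t + B ≤ A) (sym (size Ib)) (sym (size Ia))
    (≤-trans (+-monoˡ-≤ k (wBetween≤ w k (l ∸ k) t)) (≤-reflexive (m∸n+n≡m k≤l)))

  open Exchange a b f g r N g≡f+r (wBetween-mono w k (l ∸ k)) r+B≤A (dominates Ib) (dominates Ia)
    using (ExchangePair; exchange)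

  module Swap (P : ExchangePair) where

    open ExchangePair P

    ax≡0 : a x ≡ 0
    ax≡0 = m<n≤1⇒m≡0 (bit Ib x) a<b
    bx≡1 : b x ≡ 1
    bx≡1 = m<n≤1⇒n≡1 (bit Ib x) a<b
    by≡0 : b y ≡ 0
    by≡0 = m<n≤1⇒m≡0 (bit Ia y) b<a
    ay≡1 : a y ≡ 1
    ay≡1 = m<n≤1⇒n≡1 (bit Ia y) b<a

    y≢x : y ≢ x
    y≢x y≡x = 0≢1+n (trans (sym ax≡0) (trans (cong a (sym y≡x)) ay≡1))

    0<x : 0 < x
    0<x = n≢0⇒n>0 λ x≡0 → 0≢1+n (trans (sym (at-zero Ib)) (trans (cong b (sym x≡0)) bx≡1))

    0<y : 0 < y
    0<y = n≢0⇒n>0 λ y≡0 → 0≢1+n (trans (sym (at-zero Ia)) (trans (cong a (sym y≡0)) ay≡1))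

    Ia~ : IsIndicatorInA w l N (move a y x)
    Ia~ = IsIndicatorInA-move Ia ay≡1 ax≡0 0<x x<N g-shift

    Ib~ : IsIndicatorInA w k N (move b x y)
    Ib~ = IsIndicatorInA-move Ib bx≡1 by≡0 0<y y<N f-shift

    α~ β~ : List ℕ
    α~ = support (move a y x) N
    β~ = support (move b x y) N

    Aα~ : InA w l α~
    Aα~ = IsIndicatorInA⇒InA Ia~

    Aβ~ : InA w k β~
    Aβ~ = IsIndicatorInA⇒InA Ib~

    μα~ : ∀ z → μ α~ z ≡ move a y x z
    μα~ = count-support (bit Ia~) (beyond Ia~)

    μβ~ : ∀ z → μ β~ z ≡ move b x y z
    μβ~ = count-support (bit Ib~) (beyond Ib~)

    η≈~ : η ≈ₘ (α~ ⊕ β~)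
    η≈~ z = sym (trans (cong₂ _+_ (μα~ z) (μβ~ z)) (move-pair a b y x ay≡1 bx≡1 z))

    α≢α~ : α ≢ α~
    α≢α~ α≡α~ = 0≢1+n (trans (sym ax≡0) (trans (cong (count x) α≡α~) (trans (μα~ x) (move-at-o a y x ax≡0 y≢x))))

    β≢β~ : β ≢ β~
    β≢β~ β≡β~ = 0≢1+n (trans (sym (move-at-i b x y bx≡1 y≢x))
                             (trans (sym (μβ~ x)) (trans (cong (count x) (sym β≡β~)) bx≡1)))

    α≡β~⇒balanced : α ≡ β~ → k ≡ l × #β∖α ≤ 1
    α≡β~⇒balanced α≡β~ =
      trans (sym (InA-length w Aβ~)) (trans (cong length (sym α≡β~)) (InA-length w Aα)) ,
      ≤-trans (≤-reflexive (sumBelow-cong N (λ {z} _ → cong (b z ∸_) (trans (cong (count z) α≡β~) (μβ~ z)))))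
              (sumBelow-∸-move b x y N bx≡1)

    β≡α~⇒balanced : β ≡ α~ → k ≡ l × #β∖α ≤ 1
    β≡α~⇒balanced β≡α~ = k≡l , ≤-trans (≤-reflexive (sym (#α∖β≡#β∖α k≡l)))
      (≤-trans (≤-reflexive (sumBelow-cong N (λ {z} _ → cong (a z ∸_) (trans (cong (count z) β≡α~) (μα~ z)))))
               (sumBelow-∸-move a y x N ay≡1))
      where
      k≡l : k ≡ l
      k≡l = trans (sym (InA-length w Aβ)) (trans (cong length β≡α~) (InA-length w Aα~))

  exchange⇒InB : 1 ≤ #β∖α → ¬ (k ≡ l × #β∖α ≤ 1) → InB w k l η
  exchange⇒InB 1≤#β∖α unbalanced =
    α , α~ , β , β~ , Aα , Aα~ , Aβ , Aβ~ , (λ _ → refl) , η≈~ ,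
    α≢α~ , unbalanced ∘ α≡β~⇒balanced , unbalanced ∘ β≡α~⇒balanced , β≢β~
    where open Swap (exchange 1≤#β∖α)

  ¬InB⇔#β∖α≡0 : k < l → (¬ InB w k l η) ⇔ #β∖α ≡ 0
  ¬InB⇔#β∖α≡0 k<l = mk⇔ to #β∖α≡0⇒¬InB
    where
    to : ¬ InB w k l η → #β∖α ≡ 0
    to ∉B with #β∖α ≟ 0
    ... | yes #β∖α≡0 = #β∖α≡0
    ... | no  #β∖α≢0 = contradiction (exchange⇒InB (n≢0⇒n>0 #β∖α≢0) (λ (k≡l , _) → <⇒≢ k<l k≡l)) ∉B

  ¬InB⇔#β∖α≤1 : k ≡ l → (¬ InB w k l η) ⇔ #β∖α ≤ 1
  ¬InB⇔#β∖α≤1 k≡l = mk⇔ to (balanced⇒¬InB k≡l)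
    where
    to : ¬ InB w k l η → #β∖α ≤ 1
    to ∉B with #β∖α ≤? 1
    ... | yes #β∖α≤1 = #β∖α≤1
    ... | no  #β∖α≰1 =
      contradiction (exchange⇒InB (≤-trans (s≤s z≤n) (≰⇒> #β∖α≰1)) (λ (_ , #β∖α≤1) → #β∖α≰1 #β∖α≤1)) ∉B

proposition2p11 : (w : S∞) (k l : ℕ) → k ≤ l → (α β : List ℕ) →
    InA w l α → InA w k β →
    let η = α ⊕ β
        η₂ = card₂Below η (suc (sum (α ++ β)))
    in (k < l → ((¬ InB w k l η) ⇔ (β ⊆ α)) × ((β ⊆ α) ⇔ (k ≡ η₂)))
       × (k ≡ l → (¬ InB w k l η) ⇔ (k ≡ η₂ ⊎ k ≡ suc η₂))
proposition2p11 w k l k≤l α β Aα Aβ =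
  (λ k<l → ⇔-sym ⊆⇔#β∖α≡0 ⇔-∘ ¬InB⇔#β∖α≡0 k<l , ⇔-sym k≡η₂⇔#β∖α≡0 ⇔-∘ ⊆⇔#β∖α≡0) ,
  (λ k≡l → ⇔-sym k≡η₂⊎k≡1+η₂⇔#β∖α≤1 ⇔-∘ ¬InB⇔#β∖α≤1 k≡l)
  where open Decompositions w k l k≤l α β Aα Aβ
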